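{- Let $p(j)=\binom{j+4}{4}$. The largest positive integer $n$ that cannot be written as $n=\sum_{j\in S}\binom{j+4}{4}$ for some finite set $S$ of integers $j\ge 1$ is $23319$. In other words, $23319$ has no such representation, and every integer $n>23319$ has one.
   Context: A representation of $n$ as a sum of distinct values of $p(j)$ with $j\ge j_0$ means a finite set $S$ of integers, each $\ge j_0$, such that $n=\sum_{j\in S}p(j)$. Since each index is used at most once, the summands are distinct values. Here $j_0=1$, so the value $p(0)=1$ is excluded. -}

module Defs where

open import Data.Nat using (ℕ; _+_; _≤_)
open import Data.Nat.Combinatorics using (_C_)
open import Data.List using (List; map)
open import Data.Nat.ListAction using (sum)
open import Data.List.Relation.Unary.All using (All)
open import Data.List.Relation.Unary.Unique.Propositional using (Unique)
open import Data.Product using (Σ; _×_)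
open import Relation.Binary.PropositionalEquality using (_≡_)

p : ℕ → ℕ
p j = (j + 4) C 4

Representable : ℕ → Set
Representable n =
  Σ (List ℕ) λ S → Unique S × All (1 ≤_) S × sum (map p S) ≡ n

-- Any representation of 23319 uses only p(1), …, p(24), since p(25) > 23319, and
-- an exhaustive search over these finds none. Upwards, a search shows that every
-- integer in (23319, 23319 + p(22)] is a sum of distinct p(1), …, p(21). Since
-- p(j+1) ≤ 2 p(j) for j ≥ 3, Richert's argument extends such a cover: if the sums
-- of distinct p(1), …, p(k) cover (N, N + p(k+1)], then those of p(1), …, p(k+1)
-- cover (N, N + p(k+2)]; the union of these intervals is everything above 23319.
module Submission where

open import Defs
open import Data.Nat using (ℕ; _<_)
open import Data.Product using (_×_)
open import Relation.Nullary using (¬_)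

open import Relation.Binary.PropositionalEquality
open import Data.Nat using (zero; suc; _+_; _*_; _∸_; _≤_; z≤n; s≤s; s≤s⁻¹; _!; _≟_; _<?_; _≤ᵇ_; _<ᵇ_)
open import Data.Nat.Properties
open import Data.Nat.Combinatorics using (_C_; nCk≡n!/k![n-k]!; k![n∸k]!∣n!)
open import Data.Nat.DivMod using (_/_; m*[n/m]≡n)
open import Data.Nat.ListAction using (sum)
open import Data.Nat.ListAction.Properties using (sum-↭)
open import Data.Nat.Tactic.RingSolver using (solve-∀)
open import Data.List using (List; []; _∷_; _++_; map; applyDownFrom)
open import Data.List.Relation.Unary.All as All using (All; []; _∷_)
open import Data.List.Relation.Unary.All.Properties using (¬Any⇒All¬)
open import Data.List.Relation.Unary.Any using (here; there)
open import Data.List.Relation.Unary.AllPairs using ([]; _∷_)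
open import Data.List.Relation.Unary.Unique.Propositional using (Unique)
open import Data.List.Membership.Propositional using (_∈_)
open import Data.List.Membership.Propositional.Properties using (∈-∃++; ∈-map⁺)
open import Data.List.Membership.DecPropositional _≟_ using (_∈?_)
open import Data.List.Relation.Binary.Permutation.Propositional using (_↭_; ↭⇒↭ₛ)
open import Data.List.Relation.Binary.Permutation.Propositional.Properties using (shift; All-resp-↭)
import Data.List.Relation.Binary.Permutation.Propositional.Properties as ↭
open import Data.List.Relation.Binary.Permutation.Setoid.Properties (setoid ℕ) using (Unique-resp-↭)
open import Data.Maybe using (Maybe; just; nothing; _<∣>_; zipWith; from-just)
import Data.Maybe as Maybe
open import Data.Product using (∃; _,_)
open import Data.Unit using (tt)
open import Data.Bool using (true; false)
open import Function using (_∘_)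
open import Relation.Nullary using (yes; no; contradiction)
open import Relation.Nullary.Reflects using (ofʸ; ofⁿ)

quartic : ℕ → ℕ
quartic j = (1 + j) * (2 + j) * (3 + j) * (4 + j)

24*p≡quartic : ∀ j → 24 * p j ≡ quartic j
24*p≡quartic j = *-cancelʳ-≡ (24 * p j) (quartic j) (j !) {{j !≢0}} (begin
  24 * p j * j !                        ≡⟨ cong (λ m → 24 * (m C 4) * j !) (+-comm j 4) ⟩
  24 * ((4 + j) C 4) * j !              ≡⟨ swap-last ((4 + j) C 4) (j !) ⟩
  4 ! * j ! * ((4 + j) C 4)             ≡⟨ cong (4 ! * j ! *_) (nCk≡n!/k![n-k]! 4≤4+j) ⟩
  4 ! * j ! * ((4 + j) ! / (4 ! * j !)) ≡⟨ m*[n/m]≡n (k![n∸k]!∣n! 4≤4+j) ⟩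
  (4 + j) !                             ≡⟨ unfold-! j (j !) ⟩
  quartic j * j !                       ∎)
  where
  open ≡-Reasoning
  instance _ = 4 !* j !≢0
  4≤4+j = m≤m+n 4 j
  swap-last : ∀ c f → 24 * c * f ≡ 24 * f * c
  swap-last = solve-∀
  unfold-! : ∀ j f → (4 + j) * ((3 + j) * ((2 + j) * ((1 + j) * f)))
                   ≡ (1 + j) * (2 + j) * (3 + j) * (4 + j) * f
  unfold-! = solve-∀

p-mono-≤ : ∀ {j k} → j ≤ k → p j ≤ p k
p-mono-≤ {j} {k} j≤k = *-cancelˡ-≤ 24 (begin
  24 * p j  ≡⟨ 24*p≡quartic j ⟩
  quartic j ≤⟨ *-mono-≤ (*-mono-≤ (*-mono-≤ (s≤s j≤k) (+-monoʳ-≤ 2 j≤k)) (+-monoʳ-≤ 3 j≤k)) (+-monoʳ-≤ 4 j≤k) ⟩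
  quartic k ≡⟨ 24*p≡quartic k ⟨
  24 * p k  ∎)
  where open ≤-Reasoning

-- p(m+1)/p(m) = (m+5)/(m+1), which is at most 2 once m ≥ 3.
p-doubling : ∀ {m} → 3 ≤ m → p (suc m) ≤ p m + p m
p-doubling {m} 3≤m = *-cancelˡ-≤ 24 (begin
  24 * p (suc m)        ≡⟨ 24*p≡quartic (suc m) ⟩
  A * (3 + (2 + m))     ≤⟨ *-monoʳ-≤ A (+-monoˡ-≤ (2 + m) 3≤m) ⟩
  A * (m + (2 + m))     ≡⟨ twice-quartic m ⟩
  quartic m + quartic m ≡⟨ cong₂ _+_ (24*p≡quartic m) (24*p≡quartic m) ⟨
  24 * p m + 24 * p m   ≡⟨ *-distribˡ-+ 24 (p m) (p m) ⟨
  24 * (p m + p m)      ∎)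
  where
  open ≤-Reasoning
  A = (2 + m) * (3 + m) * (4 + m)
  twice-quartic : ∀ m → (2 + m) * (3 + m) * (4 + m) * (m + (2 + m))
                      ≡ (1 + m) * (2 + m) * (3 + m) * (4 + m) + (1 + m) * (2 + m) * (3 + m) * (4 + m)
  twice-quartic = solve-∀

n≤p[n] : ∀ n → n ≤ p n
n≤p[n] n = *-cancelˡ-≤ 24 (begin
  24 * n        ≡⟨ reorder n ⟩
  n * 2 * 3 * 4 ≤⟨ *-mono-≤ (*-mono-≤ (*-mono-≤ (n≤1+n n) (m≤m+n 2 n)) (m≤m+n 3 n)) (m≤m+n 4 n) ⟩
  quartic n     ≡⟨ 24*p≡quartic n ⟨
  24 * p n      ∎)
  where
  open ≤-Reasoning
  reorder : ∀ n → 24 * n ≡ n * 2 * 3 * 4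
  reorder = solve-∀

p≤23319⇒≤24 : ∀ {j} → p j ≤ 23319 → j ≤ 24
p≤23319⇒≤24 {j} pj≤ = ≮⇒≥ λ 24<j →
  <⇒≱ (≤-trans (≤ᵇ⇒≤ 23320 (p 25) tt) (p-mono-≤ 24<j)) pj≤

data SubsetSum : List ℕ → ℕ → Set where
  []   : SubsetSum [] 0
  skip : ∀ {v vs n} → SubsetSum vs n → SubsetSum (v ∷ vs) n
  take : ∀ {v vs n} → SubsetSum vs n → SubsetSum (v ∷ vs) (v + n)

subsetSum≤sum : ∀ {vs n} → SubsetSum vs n → n ≤ sum vs
subsetSum≤sum []               = z≤n
subsetSum≤sum (skip {v = v} s) = ≤-trans (subsetSum≤sum s) (m≤n+m _ v)
subsetSum≤sum (take {v = v} s) = +-monoʳ-≤ v (subsetSum≤sum s)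

takeHead : ∀ v {vs} n → Maybe (SubsetSum vs (n ∸ v)) → Maybe (SubsetSum (v ∷ vs) n)
takeHead v {vs} n x with v ≤ᵇ n | ≤ᵇ-reflects-≤ v n
... | true  | ofʸ v≤n = Maybe.map (subst (SubsetSum (v ∷ vs)) (m+[n∸m]≡n v≤n) ∘ take) x
... | false | _       = nothing

-- t is an upper bound for sum vs; it only prunes the search, but without the
-- pruning the evaluations in the proof of the theorem are out of reach.
find : ∀ vs n (t : ℕ) → Maybe (SubsetSum vs n)
find []       zero    _ = just []
find []       (suc _) _ = nothing
find (v ∷ vs) n       t with t <ᵇ n
... | true  = nothing
... | false = takeHead v n (find vs (n ∸ v) (t ∸ v)) <∣> Maybe.map skip (find vs n (t ∸ v))

map-≢nothing : ∀ {A B : Set} {f : A → B} {x} → x ≢ nothing → Maybe.map f x ≢ nothing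
map-≢nothing {x = just _}  _  ()
map-≢nothing {x = nothing} x≢ = contradiction refl x≢

<∣>-≢nothingˡ : ∀ {A : Set} {x y : Maybe A} → x ≢ nothing → (x <∣> y) ≢ nothing
<∣>-≢nothingˡ {x = just _}  _  ()
<∣>-≢nothingˡ {x = nothing} x≢ = contradiction refl x≢

<∣>-≢nothingʳ : ∀ {A : Set} {x y : Maybe A} → y ≢ nothing → (x <∣> y) ≢ nothing
<∣>-≢nothingʳ {x = just _}  _  ()
<∣>-≢nothingʳ {x = nothing} y≢ = y≢

sum-tail≤ : ∀ v vs {t} → sum (v ∷ vs) ≤ t → sum vs ≤ t ∸ v
sum-tail≤ v vs {t} h = m+n≤o⇒m≤o∸n (sum vs) (subst (_≤ t) (+-comm v (sum vs)) h)

takeHead-complete : ∀ {v vs n} {x : Maybe (SubsetSum vs (n ∸ v))} →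
                    v ≤ n → x ≢ nothing → takeHead v n x ≢ nothing
takeHead-complete {v} {n = n} v≤n x≢ with v ≤ᵇ n | ≤ᵇ-reflects-≤ v n
... | true  | ofʸ _   = map-≢nothing x≢
... | false | ofⁿ v≰n = contradiction v≤n v≰n

find-complete : ∀ {vs n} t → sum vs ≤ t → SubsetSum vs n → find vs n t ≢ nothing
find-complete t _ [] ()
find-complete {v ∷ vs} {n} t sum≤t s with t <ᵇ n | <ᵇ-reflects-< t n
... | true  | ofʸ t<n = λ _ → <⇒≱ t<n (≤-trans (subsetSum≤sum s) sum≤t)
... | false | _       with s
...   | skip s′ = <∣>-≢nothingʳ (map-≢nothing (find-complete (t ∸ v) (sum-tail≤ v vs sum≤t) s′))
...   | take {n = m} s′ = <∣>-≢nothingˡ (takeHead-complete (m≤m+n v m)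
        (subst (λ k → find vs k (t ∸ v) ≢ nothing) (sym (m+n∸m≡n v m))
               (find-complete (t ∸ v) (sum-tail≤ v vs sum≤t) s′)))

-- Every integer in (N, N + m] is a subset sum of vs. The offset is added as d + suc N
-- so that, for a numeral N, the sum is stuck on d rather than unfolding N into sucs.
CoversInterval : List ℕ → ℕ → ℕ → Set
CoversInterval vs N m = ∀ {d} → d < m → SubsetSum vs (d + suc N)

coversInterval-suc : ∀ {vs N m} → SubsetSum vs (m + suc N) → CoversInterval vs N m →
                     CoversInterval vs N (suc m)
coversInterval-suc {m = m} s cov {d} d<1+m with d ≟ m
... | yes refl = s
... | no d≢m   = cov (≤∧≢⇒< (s≤s⁻¹ d<1+m) d≢m)

findCover : ∀ vs (t N m : ℕ) → Maybe (CoversInterval vs N m)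
findCover vs t N zero    = just λ ()
findCover vs t N (suc m) = zipWith coversInterval-suc (find vs (m + suc N) t) (findCover vs t N m)

-- Richert's lemma: a target beyond N + v, minus v, lands back in (N, N + v].
coversInterval-∷ : ∀ {v w vs N} → w ≤ v + v → CoversInterval vs N v → CoversInterval (v ∷ vs) N w
coversInterval-∷ {v} {w} {vs} {N} w≤2v cov {d} d<w with d <? v
... | yes d<v = skip (cov d<v)
... | no d≮v with e , refl ← m≤n⇒∃[o]m+o≡n (≮⇒≥ d≮v) =
  subst (SubsetSum (v ∷ vs)) (sym (+-assoc v e (suc N)))
        (take (cov (+-cancelˡ-< v e v (<-≤-trans d<w w≤2v))))

valuesUpTo : (ℕ → ℕ) → ℕ → List ℕ
valuesUpTo f = applyDownFrom (f ∘ suc)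

coversInterval-valuesUpTo : ∀ {f k N} → (∀ {j} → k ≤ j → f (2 + j) ≤ f (1 + j) + f (1 + j)) →
  CoversInterval (valuesUpTo f k) N (f (1 + k)) →
  ∀ d → CoversInterval (valuesUpTo f (d + k)) N (f (1 + (d + k)))
coversInterval-valuesUpTo doubling base zero    = base
coversInterval-valuesUpTo {f} {k} doubling base (suc d) =
  coversInterval-∷ (doubling (m≤n+m k d)) (coversInterval-valuesUpTo {f} doubling base d)

DistinctIndices : ℕ → List ℕ → Set
DistinctIndices k S = Unique S × All (1 ≤_) S × All (_≤ k) S

subsetSum⇒indices : ∀ {f} k {n} → SubsetSum (valuesUpTo f k) n →
                    ∃ λ S → DistinctIndices k S × sum (map f S) ≡ n
subsetSum⇒indices zero [] = [] , ([] , [] , []) , refl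
subsetSum⇒indices (suc k) (skip s) with S , (u , pos , ≤k) , sum≡ ← subsetSum⇒indices k s =
  S , (u , pos , All.map m≤n⇒m≤1+n ≤k) , sum≡
subsetSum⇒indices {f} (suc k) (take s) with S , (u , pos , ≤k) , sum≡ ← subsetSum⇒indices k s =
  suc k ∷ S , (All.map (>⇒≢ ∘ s≤s) ≤k ∷ u , s≤s z≤n ∷ pos , ≤-refl ∷ All.map m≤n⇒m≤1+n ≤k) ,
  cong (f (suc k) +_) sum≡

∈⇒↭∷ : ∀ {A : Set} {x : A} {xs} → x ∈ xs → ∃ λ ys → xs ↭ x ∷ ys
∈⇒↭∷ x∈xs with ys , zs , refl ← ∈-∃++ x∈xs = ys ++ zs , shift _ ys zs

≤suc∧≢⇒≤ : ∀ {k S} → All (λ j → ¬ suc k ≡ j) S → All (_≤ suc k) S → All (_≤ k) S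
≤suc∧≢⇒≤ ≢k ≤1+k = All.zipWith (λ (k≢j , j≤1+k) → s≤s⁻¹ (≤∧≢⇒< j≤1+k (k≢j ∘ sym))) (≢k , ≤1+k)

DistinctIndices-↭ : ∀ {k S S′} → S ↭ S′ → DistinctIndices k S → DistinctIndices k S′
DistinctIndices-↭ S↭ (u , pos , ≤k) = Unique-resp-↭ (↭⇒↭ₛ S↭) u , All-resp-↭ S↭ pos , All-resp-↭ S↭ ≤k

DistinctIndices-uncons : ∀ {k S} → DistinctIndices (suc k) (suc k ∷ S) → DistinctIndices k S
DistinctIndices-uncons (k∉S ∷ u , _ ∷ pos , _ ∷ ≤1+k) = u , pos , ≤suc∧≢⇒≤ k∉S ≤1+k

indices⇒subsetSum : ∀ {f} k {S} → DistinctIndices k S → SubsetSum (valuesUpTo f k) (sum (map f S))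
indices⇒subsetSum zero {[]}    _                        = []
indices⇒subsetSum zero {_ ∷ _} (_ , 1≤j ∷ _ , j≤0 ∷ _) = contradiction j≤0 (<⇒≱ 1≤j)
indices⇒subsetSum (suc k) {S} ds@(u , pos , ≤1+k) with suc k ∈? S
... | no  k∉S = skip (indices⇒subsetSum k (u , pos , ≤suc∧≢⇒≤ (¬Any⇒All¬ S k∉S) ≤1+k))
... | yes k∈S with S′ , S↭ ← ∈⇒↭∷ k∈S =
  subst (SubsetSum _) (sym (sum-↭ (↭.map⁺ _ S↭)))
        (take (indices⇒subsetSum k (DistinctIndices-uncons (DistinctIndices-↭ S↭ ds))))

∈⇒≤sum : ∀ {n ns} → n ∈ ns → n ≤ sum ns
∈⇒≤sum {ns = n ∷ ns} (here refl) = m≤m+n n (sum ns)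
∈⇒≤sum {ns = m ∷ ns} (there n∈ns) = ≤-trans (∈⇒≤sum n∈ns) (m≤n+m (sum ns) m)

unrepresentable-23319 : ¬ Representable 23319
unrepresentable-23319 (S , u , pos , sum≡) =
  find-complete (sum (valuesUpTo p 24)) ≤-refl
    (subst (SubsetSum (valuesUpTo p 24)) sum≡ (indices⇒subsetSum 24 (u , pos , ≤24)))
    refl  -- the search evaluates to nothing
  where
  ≤24 : All (_≤ 24) S
  ≤24 = All.tabulate λ j∈S → p≤23319⇒≤24 (subst (_ ≤_) sum≡ (∈⇒≤sum (∈-map⁺ p j∈S)))

initialCover : CoversInterval (valuesUpTo p 21) 23319 (p 22)
initialCover = from-just (findCover (valuesUpTo p 21) (sum (valuesUpTo p 21)) 23319 (p 22))

covers-above-23319 : ∀ d → CoversInterval (valuesUpTo p (d + 21)) 23319 (p (1 + (d + 21)))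
covers-above-23319 = coversInterval-valuesUpTo {p} {21} {23319}
  (λ 21≤j → p-doubling (≤-trans (m≤m+n 3 19) (s≤s 21≤j))) initialCover

subsetSum⇒representable : ∀ k {n} → SubsetSum (valuesUpTo p k) n → Representable n
subsetSum⇒representable k s with S , (u , pos , _) , sum≡ ← subsetSum⇒indices k s = S , u , pos , sum≡

representable-above-23319 : ∀ n → 23319 < n → Representable n
representable-above-23319 n 23319<n =
  subst Representable (m∸n+n≡m 23319<n)
        (subsetSum⇒representable (d + 21) (covers-above-23319 d {d} d<p[22+d]))
  where
  d = n ∸ 23320
  d<p[22+d] : d < p (1 + (d + 21))
  d<p[22+d] = <-≤-trans (s≤s (m≤m+n d 21)) (n≤p[n] _)

mainTheorem2 : ¬ Representable 23319 × ((n : ℕ) → 23319 < n → Representable n)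
mainTheorem2 = unrepresentable-23319 , representable-above-23319
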